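{- Let $\Gamma=(G,\sigma)$ be a signed graph with girth $g$ (so $\Gamma$ contains a cycle), and let $C_g^\sigma$ be a shortest signed cycle of $\Gamma$. Let $x\notin V(C_g^\sigma)$, and let $k\ge 1$ and $l\ge 1$ be integers. If there exists a $k$-fan of length $l$ from $x$ to $V(C_g^\sigma)$, then $\lfloor \frac{g}{k}\rfloor+2l\geq g$.
   Context: A signed graph $\Gamma=(G,\sigma)$ is a simple graph $G$ together with a sign function $\sigma:E(G)\to\{+,-\}$; its girth is the length of a shortest cycle of $G$. For a vertex $x$ and a vertex set $Y$ with $x\notin Y$, an $(x,Y)$-path is a path from $x$ to a vertex of $Y$. A $k$-fan from $x$ to $Y$ is a family of $k$ internally (vertex-)disjoint $(x,Y)$-paths whose terminal vertices (in $Y$) are pairwise distinct; it is a $k$-fan of length $l$ if all $k$ paths have length $l$. -}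

module Defs where

open import Data.Nat using (ℕ; zero; suc; _≤_; _<_; _+_)
open import Data.Nat.Properties using (_<?_)
open import Data.Fin using (Fin; toℕ; fromℕ<; fromℕ; inject₁) renaming (zero to fzero; suc to fsuc)
open import Data.Bool using (Bool)
open import Data.Product using (Σ; _×_; ∃)
open import Relation.Binary.PropositionalEquality using (_≡_; _≢_)
open import Relation.Nullary using (¬_; yes; no)
open import Function.Definitions using (Injective)

record SimpleGraph (n : ℕ) : Set₁ where
  field
    Adj    : Fin n → Fin n → Set
    sym    : ∀ {u v} → Adj u v → Adj v u
    irrefl : ∀ {u} → ¬ Adj u u
open SimpleGraph public

-- Signs: true = '+', false = '-'.
Sign : Set
Sign = Bool

record SignedGraph (n : ℕ) : Set₁ where
  field
    graph : SimpleGraph n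
    σ     : (u v : Fin n) → Adj graph u v → Sign
    σ-sym : ∀ {u v} (e : Adj graph u v) → σ u v e ≡ σ v u (sym graph e)
open SignedGraph public

next : ∀ {m} → Fin m → Fin m
next {suc m} i with suc (toℕ i) <? suc m
... | yes p = fromℕ< p
... | no _  = fzero

record Cycle {n : ℕ} (G : SimpleGraph n) (m : ℕ) : Set where
  field
    len≥3 : 3 ≤ m
    vtx   : Fin m → Fin n
    inj   : Injective _≡_ _≡_ vtx
    adj   : ∀ i → Adj G (vtx i) (vtx (next i))
open Cycle public

HasGirth : ∀ {n} → SimpleGraph n → ℕ → Set
HasGirth G g = Cycle G g × (∀ m → Cycle G m → g ≤ m)

_∈C_ : ∀ {n m} {G : SimpleGraph n} → Fin n → Cycle G m → Set
_∈C_ {m = m} v C = ∃ λ (i : Fin m) → vtx C i ≡ v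

record Path {n : ℕ} (G : SimpleGraph n) (l : ℕ) : Set where
  field
    pv   : Fin (suc l) → Fin n
    pinj : Injective _≡_ _≡_ pv
    padj : ∀ (i : Fin l) → Adj G (pv (inject₁ i)) (pv (fsuc i))
open Path public

start end : ∀ {n l} {G : SimpleGraph n} → Path G l → Fin n
start P = pv P fzero
end {l = l} P = pv P (fromℕ l)

record Fan {n m : ℕ} (G : SimpleGraph n) (x : Fin n) (C : Cycle G m) (k l : ℕ) : Set where
  field
    path     : Fin k → Path G l
    starts   : ∀ j → start (path j) ≡ x
    ends     : ∀ j → end (path j) ∈C C
    disjoint : ∀ j j' → j ≢ j' → ∀ a b → pv (path j) a ≡ pv (path j') b → (a ≡ fzero × b ≡ fzero)
    endsDist : ∀ j j' → j ≢ j' → end (path j) ≢ end (path j')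
open Fan public

{-# OPTIONS --safe #-}
-- Follow each of the k fan paths from x up to its first vertex on C. These first contact
-- points are pairwise distinct, because the paths meet only in x. Sending (j, s), with
-- s ≤ ⌊g/k⌋, to the vertex s steps after the j-th contact point along C maps
-- k (⌊g/k⌋ + 1) > g pairs into the g vertices of C, so a collision yields two contact
-- points joined by a forward arc of C of length d with 1 ≤ d ≤ ⌊g/k⌋. The two path
-- prefixes (each of length at most l) together with this arc form a cycle of length at
-- most 2l + ⌊g/k⌋, which the girth g bounds from below.
module Submission where

open import Defs hiding (sym)
open import Data.Nat using (ℕ; zero; suc; _≤_; _<_; _+_; _*_; _∸_; NonZero; z≤n; s≤s; s≤s⁻¹; z<s)
open import Data.Nat.Properties
open import Data.Nat.Tactic.RingSolver using (solve-∀)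
open import Data.Nat.DivMod using (_/_; _%_; n/1≡n; m/n<m; m≡m%n+[m/n]*n; m<n⇒m%n≡m; n%n≡0; m%n%n≡m%n; %-distribˡ-+; m%n<n)
open import Data.Nat.Divisibility using (_∣_; divides; ∣m+n∣m⇒∣n; n∣m*n; >⇒∤)
open import Data.Fin using (Fin; toℕ; fromℕ; fromℕ<; inject; inject₁; remQuot; combine) renaming (zero to fzero; suc to fsuc)
import Data.Fin.Properties as Fin
open import Data.Product using (∃₂; _×_; _,_; proj₁; proj₂; uncurry)
open import Data.Sum using (inj₁; inj₂; [_,_]′)
open import Function using (_∘_)
open import Relation.Binary.PropositionalEquality
open import Relation.Nullary using (¬_; Dec; yes; no; contradiction; ¬?)
open import Relation.Nullary.Decidable using (decidable-stable)

[m+n]%d≡m%d⇒d∣n : ∀ {d} m n .{{_ : NonZero d}} → (m + n) % d ≡ m % d → d ∣ n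
[m+n]%d≡m%d⇒d∣n {d} m n eq = ∣m+n∣m⇒∣n (divides ((m + n) / d) quotients) (n∣m*n (m / d))
  where
  open ≡-Reasoning
  quotients : m / d * d + n ≡ (m + n) / d * d
  quotients = +-cancelˡ-≡ (m % d) _ _ (begin
    m % d + (m / d * d + n)       ≡⟨ +-assoc (m % d) _ n ⟨
    m % d + m / d * d + n         ≡⟨ cong (_+ n) (m≡m%n+[m/n]*n m d) ⟨
    m + n                         ≡⟨ m≡m%n+[m/n]*n (m + n) d ⟩
    (m + n) % d + (m + n) / d * d ≡⟨ cong (_+ (m + n) / d * d) eq ⟩
    m % d + (m + n) / d * d       ∎)

∣∧<⇒≡0 : ∀ {d e} → d ∣ e → e < d → e ≡ 0
∣∧<⇒≡0 {e = zero}  _   _   = refl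
∣∧<⇒≡0 {e = suc _} d∣e e<d = contradiction d∣e (>⇒∤ e<d)

%-cancelʳ-+ : ∀ {d x y} z .{{_ : NonZero d}} → x < d → y < d → (x + z) % d ≡ (y + z) % d → x ≡ y
%-cancelʳ-+ {d} z x<d y<d eq =
  [ (λ x≤y → cancel x≤y y<d eq) , (λ y≤x → sym (cancel y≤x x<d (sym eq))) ]′ (≤-total _ _)
  where
  cancel : ∀ {x y} → x ≤ y → y < d → (x + z) % d ≡ (y + z) % d → x ≡ y
  cancel {x} {y} x≤y y<d eq = ≤-antisym x≤y (m∸n≡0⇒m≤n y∸x≡0)
    where
    shift : x + z + (y ∸ x) ≡ y + z
    shift = trans (+-comm (x + z) _) (trans (sym (+-assoc (y ∸ x) x z)) (cong (_+ z) (m∸n+n≡m x≤y)))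
    y∸x≡0 : y ∸ x ≡ 0
    y∸x≡0 = ∣∧<⇒≡0 ([m+n]%d≡m%d⇒d∣n (x + z) (y ∸ x) (trans (cong (_% d) shift) (sym eq)))
                   (≤-<-trans (m∸n≤m y x) y<d)

[1+m%n]%n≡[1+m]%n : ∀ m n .{{_ : NonZero n}} → suc (m % n) % n ≡ suc m % n
[1+m%n]%n≡[1+m]%n m n = begin
  (1 + m % n) % n         ≡⟨ %-distribˡ-+ 1 (m % n) n ⟩
  (1 % n + m % n % n) % n ≡⟨ cong (λ r → (1 % n + r) % n) (m%n%n≡m%n m n) ⟩
  (1 % n + m % n) % n     ≡⟨ %-distribˡ-+ 1 m n ⟨
  (1 + m) % n             ∎
  where open ≡-Reasoning

m<n*[1+m/n] : ∀ m n .{{_ : NonZero n}} → m < n * suc (m / n)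
m<n*[1+m/n] m n = begin-strict
  m                 ≡⟨ m≡m%n+[m/n]*n m n ⟩
  m % n + m / n * n <⟨ +-monoˡ-< (m / n * n) (m%n<n m n) ⟩
  n + m / n * n     ≡⟨ *-comm (suc (m / n)) n ⟩
  n * suc (m / n)   ∎
  where open ≤-Reasoning

x+[y+x]≡y+2*x : ∀ x y → x + (y + x) ≡ y + 2 * x
x+[y+x]≡y+2*x = solve-∀

toℕ-next : ∀ {m} (i : Fin (suc m)) → toℕ (next i) ≡ suc (toℕ i) % suc m
toℕ-next {m} i with suc (toℕ i) <? suc m
... | yes i+1<m+1 = trans (Fin.toℕ-fromℕ< i+1<m+1) (sym (m<n⇒m%n≡m i+1<m+1))
... | no  i+1≮m+1 = sym (trans (cong (_% suc m) i+1≡m+1) (n%n≡0 (suc m)))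
  where
  i+1≡m+1 : suc (toℕ i) ≡ suc m
  i+1≡m+1 = ≤-antisym (Fin.toℕ<n i) (≮⇒≥ i+1≮m+1)

rotate : ∀ {m} → Fin m → ℕ → Fin m
rotate i zero    = i
rotate i (suc e) = next (rotate i e)

toℕ-rotate : ∀ {m} (i : Fin (suc m)) e → toℕ (rotate i e) ≡ (toℕ i + e) % suc m
toℕ-rotate {m} i zero = begin
  toℕ i               ≡⟨ m<n⇒m%n≡m (Fin.toℕ<n i) ⟨
  toℕ i % suc m       ≡⟨ cong (_% suc m) (+-identityʳ (toℕ i)) ⟨
  (toℕ i + 0) % suc m ∎
  where open ≡-Reasoning
toℕ-rotate {m} i (suc e) = begin
  toℕ (next (rotate i e))           ≡⟨ toℕ-next (rotate i e) ⟩
  suc (toℕ (rotate i e)) % suc m    ≡⟨ cong (λ r → suc r % suc m) (toℕ-rotate i e) ⟩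
  suc ((toℕ i + e) % suc m) % suc m ≡⟨ [1+m%n]%n≡[1+m]%n (toℕ i + e) (suc m) ⟩
  suc (toℕ i + e) % suc m           ≡⟨ cong (_% suc m) (+-suc (toℕ i) e) ⟨
  (toℕ i + suc e) % suc m           ∎
  where open ≡-Reasoning

rotate-+ : ∀ {m} (i : Fin m) a b → rotate (rotate i a) b ≡ rotate i (a + b)
rotate-+ i a zero    = cong (rotate i) (sym (+-identityʳ a))
rotate-+ i a (suc b) = trans (cong next (rotate-+ i a b)) (cong (rotate i) (sym (+-suc a b)))

rotate-cancelʳ : ∀ {m} {i j : Fin (suc m)} e → rotate i e ≡ rotate j e → i ≡ j
rotate-cancelʳ {i = i} {j} e eq = Fin.toℕ-injective (%-cancelʳ-+ e (Fin.toℕ<n i) (Fin.toℕ<n j)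
  (trans (sym (toℕ-rotate i e)) (trans (cong toℕ eq) (toℕ-rotate j e))))

rotate-injective : ∀ {m} {s s'} (i : Fin (suc m)) → s < suc m → s' < suc m →
                   rotate i s ≡ rotate i s' → s ≡ s'
rotate-injective {m} {s} {s'} i s<m+1 s'<m+1 eq = %-cancelʳ-+ (toℕ i) s<m+1 s'<m+1 (begin
  (s + toℕ i) % suc m  ≡⟨ cong (_% suc m) (+-comm s (toℕ i)) ⟩
  (toℕ i + s) % suc m  ≡⟨ toℕ-rotate i s ⟨
  toℕ (rotate i s)     ≡⟨ cong toℕ eq ⟩
  toℕ (rotate i s')    ≡⟨ toℕ-rotate i s' ⟩
  (toℕ i + s') % suc m ≡⟨ cong (_% suc m) (+-comm (toℕ i) s') ⟩
  (s' + toℕ i) % suc m ∎)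
  where open ≡-Reasoning

rotate-meet : ∀ {m s s'} {i j : Fin (suc m)} → s ≤ s' → rotate i s ≡ rotate j s' →
              i ≡ rotate j (s' ∸ s)
rotate-meet {s = s} {s'} {i} {j} s≤s' eq = rotate-cancelʳ s (begin
  rotate i s                   ≡⟨ eq ⟩
  rotate j s'                  ≡⟨ cong (rotate j) (m∸n+n≡m s≤s') ⟨
  rotate j (s' ∸ s + s)        ≡⟨ rotate-+ j (s' ∸ s) s ⟨
  rotate (rotate j (s' ∸ s)) s ∎)
  where open ≡-Reasoning

pigeonhole-× : ∀ {M k n} → M < k * n → (f : Fin k → Fin n → Fin M) →
               ∃₂ λ u v → u ≢ v × uncurry f u ≡ uncurry f v
pigeonhole-× {k = k} {n} M<kn f with i , i' , i<i' , eq ← Fin.pigeonhole M<kn (uncurry f ∘ remQuot n) =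
  remQuot {k} n i , remQuot {k} n i' , remQuot≢ , eq
  where
  remQuot≢ : remQuot {k} n i ≢ remQuot {k} n i'
  remQuot≢ same = Fin.<⇒≢ i<i' (begin
    i                                        ≡⟨ Fin.combine-remQuot {k} n i ⟨
    uncurry (combine {k}) (remQuot {k} n i)  ≡⟨ cong (uncurry (combine {k})) same ⟩
    uncurry (combine {k}) (remQuot {k} n i') ≡⟨ Fin.combine-remQuot {k} n i' ⟩
    i'                                       ∎)
    where open ≡-Reasoning

record ShortArc {m k} (p : Fin k → Fin (suc m)) (q : ℕ) : Set where
  field
    from to  : Fin k
    from≢to  : from ≢ to
    length   : ℕ
    1≤length : 1 ≤ length
    length≤q : length ≤ q
    arrives  : rotate (p from) length ≡ p to

module _ {m k q} (p : Fin k → Fin (suc m)) (p-distinct : ∀ {j j'} → j ≢ j' → p j ≢ p j')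
         (q<m+1 : q < suc m) where

  private
    meet⇒ShortArc : ∀ {j j' e} → e ≤ q → (j ≡ j' → e ≢ 0) → p j ≡ rotate (p j') e → ShortArc p q
    meet⇒ShortArc {j} {j'} {e} e≤q same⇒e≢0 meet with j Fin.≟ j'
    ... | yes refl =
      contradiction (sym (rotate-injective (p j) z<s (≤-<-trans e≤q q<m+1) meet)) (same⇒e≢0 refl)
    ... | no j≢j'  = record
      { from = j' ; to = j ; from≢to = j≢j' ∘ sym ; length = e
      ; 1≤length = n≢0⇒n>0 (λ e≡0 → p-distinct j≢j' (trans meet (cong (rotate (p j')) e≡0)))
      ; length≤q = e≤q ; arrives = sym meet }

    collision⇒ShortArc : ∀ {j j'} {s s' : Fin (suc q)} → (j , s) ≢ (j' , s') → toℕ s ≤ toℕ s' →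
                         rotate (p j) (toℕ s) ≡ rotate (p j') (toℕ s') → ShortArc p q
    collision⇒ShortArc {j} {j'} {s} {s'} pairs≢ s≤s' eq =
      meet⇒ShortArc {j} {j'} {toℕ s' ∸ toℕ s}
        (≤-trans (m∸n≤m (toℕ s') (toℕ s)) (s≤s⁻¹ (Fin.toℕ<n s')))
        (λ { refl e≡0 → pairs≢ (cong (_ ,_) (Fin.toℕ-injective (≤-antisym s≤s' (m∸n≡0⇒m≤n e≡0)))) })
        (rotate-meet s≤s' eq)

  short-arc : suc m < k * suc q → ShortArc p q
  short-arc lt with (j , s) , (j' , s') , pairs≢ , eq ← pigeonhole-× lt (λ j s → rotate (p j) (toℕ s)) =
    [ (λ s≤s' → collision⇒ShortArc pairs≢ s≤s' eq)
    , (λ s'≤s → collision⇒ShortArc (pairs≢ ∘ sym) s'≤s (sym eq))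
    ]′ (≤-total (toℕ s) (toℕ s'))

IsWalk : ∀ {n} → SimpleGraph n → ℕ → (ℕ → Fin n) → Set
IsWalk G L w = ∀ {s} → s < L → Adj G (w s) (w (suc s))

InjectiveBelow : ∀ {A : Set} → ℕ → (ℕ → A) → Set
InjectiveBelow L w = ∀ {s s'} → s < L → s' < L → w s ≡ w s' → s ≡ s'

closedWalk⇒Cycle : ∀ {n L} {G : SimpleGraph n} {w : ℕ → Fin n} →
                   3 ≤ L → IsWalk G L w → w L ≡ w 0 → InjectiveBelow L w → Cycle G L
closedWalk⇒Cycle {L = suc L} {G} {w} 3≤L walk closed injective = record
  { len≥3 = 3≤L
  ; vtx   = w ∘ toℕ
  ; inj   = λ eq → Fin.toℕ-injective (injective (Fin.toℕ<n _) (Fin.toℕ<n _) eq)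
  ; adj   = λ i → subst (Adj G (w (toℕ i)))
                        (trans (periodic (Fin.toℕ<n i)) (cong w (sym (toℕ-next i))))
                        (walk (Fin.toℕ<n i))
  }
  where
  periodic : ∀ {s} → s < suc L → w (suc s) ≡ w (suc s % suc L)
  periodic s<L with m≤n⇒m<n∨m≡n s<L
  ... | inj₁ s+1<L = cong w (sym (m<n⇒m%n≡m s+1<L))
  ... | inj₂ refl  = trans closed (cong w (sym (n%n≡0 (suc L))))

_⟨_⟩++_ : ∀ {A : Set} → (ℕ → A) → ℕ → (ℕ → A) → ℕ → A
(v ⟨ a ⟩++ w) s with s <? a
... | yes _ = v s
... | no  _ = w (s ∸ a)

data Side (a : ℕ) : ℕ → Set where
  left  : ∀ {s} → s < a → Side a s
  right : ∀ s → Side a (a + s)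

side : ∀ a s → Side a s
side a s with s <? a
... | yes s<a = left s<a
... | no  s≮a = subst (Side a) (m+[n∸m]≡n (≮⇒≥ s≮a)) (right (s ∸ a))

module _ {A : Set} (v w : ℕ → A) (a : ℕ) where

  ++-< : ∀ {s} → s < a → (v ⟨ a ⟩++ w) s ≡ v s
  ++-< {s} s<a with s <? a
  ... | yes _   = refl
  ... | no  s≮a = contradiction s<a s≮a

  ++-+ : ∀ s → (v ⟨ a ⟩++ w) (a + s) ≡ w s
  ++-+ s with a + s <? a
  ... | yes a+s<a = contradiction a+s<a (m+n≮m a s)
  ... | no  _     = cong w (m+n∸m≡n a s)

  ++-≤ : v a ≡ w 0 → ∀ {s} → s ≤ a → (v ⟨ a ⟩++ w) s ≡ v s
  ++-≤ joint s≤a with m≤n⇒m<n∨m≡n s≤a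
  ... | inj₁ s<a = ++-< s<a
  ... | inj₂ refl = begin
    (v ⟨ a ⟩++ w) a       ≡⟨ cong (v ⟨ a ⟩++ w) (+-identityʳ a) ⟨
    (v ⟨ a ⟩++ w) (a + 0) ≡⟨ ++-+ 0 ⟩
    w 0                   ≡⟨ joint ⟨
    v a                   ∎
    where open ≡-Reasoning

  ++-suc : ∀ s → (v ⟨ a ⟩++ w) (suc (a + s)) ≡ w (suc s)
  ++-suc s = trans (cong (v ⟨ a ⟩++ w) (sym (+-suc a s))) (++-+ (suc s))

++-walk : ∀ {n} {G : SimpleGraph n} {v w a b} → IsWalk G a v → IsWalk G b w → v a ≡ w 0 →
          IsWalk G (a + b) (v ⟨ a ⟩++ w)
++-walk {G = G} {v} {w} {a} {b} v-walk w-walk joint {s} s<a+b with side a s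
... | left s<a = subst₂ (Adj G) (sym (++-< v w a s<a)) (sym (++-≤ v w a joint s<a)) (v-walk s<a)
... | right t  = subst₂ (Adj G) (sym (++-+ v w a t)) (sym (++-suc v w a t)) (w-walk (+-cancelˡ-< a t b s<a+b))

++-injective : ∀ {A : Set} {v w : ℕ → A} {a b} → InjectiveBelow a v → InjectiveBelow b w →
               (∀ {s s'} → s < a → s' < b → v s ≢ w s') → InjectiveBelow (a + b) (v ⟨ a ⟩++ w)
++-injective {v = v} {w} {a} {b} v-inj w-inj disjoint {s} {s'} s<a+b s'<a+b eq with side a s | side a s'
... | left s<a | left s'<a = v-inj s<a s'<a (trans (sym (++-< v w a s<a)) (trans eq (++-< v w a s'<a)))
... | left s<a | right t'  = contradiction (trans (sym (++-< v w a s<a)) (trans eq (++-+ v w a t')))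
                               (disjoint s<a (+-cancelˡ-< a t' b s'<a+b))
... | right t  | left s'<a = contradiction (trans (sym (++-< v w a s'<a)) (trans (sym eq) (++-+ v w a t)))
                               (disjoint s'<a (+-cancelˡ-< a t b s<a+b))
... | right t  | right t'  = cong (a +_) (w-inj (+-cancelˡ-< a t b s<a+b) (+-cancelˡ-< a t' b s'<a+b)
                               (trans (sym (++-+ v w a t)) (trans eq (++-+ v w a t'))))

reverse : ∀ {A : Set} → ℕ → (ℕ → A) → ℕ → A
reverse b w s = w (b ∸ s)

reverse-walk : ∀ {n} {G : SimpleGraph n} {w b} → IsWalk G b w → IsWalk G b (reverse b w)
reverse-walk {G = G} {w} {b} walk {s} s<b =
  subst (λ r → Adj G (w r) (w (b ∸ suc s))) (sym (+-∸-assoc 1 s<b))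
        (SimpleGraph.sym G (walk (∸-monoʳ-< z<s s<b)))

reverse-injective : ∀ {A : Set} {w : ℕ → A} {b} →
                    InjectiveBelow (suc b) w → InjectiveBelow (suc b) (reverse b w)
reverse-injective {b = b} inj {s} {s'} s<b+1 s'<b+1 eq =
  ∸-cancelˡ-≡ (s≤s⁻¹ s<b+1) (s≤s⁻¹ s'<b+1) (inj (s≤s (m∸n≤m b s)) (s≤s (m∸n≤m b s')) eq)

module _ {n l} {G : SimpleGraph n} (P : Path G l) where

  walkOf : ℕ → Fin n
  walkOf s with s <? suc l
  ... | yes s<l+1 = pv P (fromℕ< s<l+1)
  ... | no  _     = start P  -- junk: only steps 0 … l are meaningful

  walkOf-toℕ : ∀ i → walkOf (toℕ i) ≡ pv P i
  walkOf-toℕ i with toℕ i <? suc l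
  ... | yes i<l+1 = cong (pv P) (Fin.fromℕ<-toℕ i i<l+1)
  ... | no  i≮l+1 = contradiction (Fin.toℕ<n i) i≮l+1

  walkOf-fromℕ< : ∀ {s} (s<l+1 : s < suc l) → walkOf s ≡ pv P (fromℕ< s<l+1)
  walkOf-fromℕ< s<l+1 = trans (cong walkOf (sym (Fin.toℕ-fromℕ< s<l+1))) (walkOf-toℕ _)

  walkOf-isWalk : IsWalk G l walkOf
  walkOf-isWalk {s} s<l =
    subst₂ (Adj G) (pv≡walkOf (inject₁ i) (trans (Fin.toℕ-inject₁ i) (Fin.toℕ-fromℕ< s<l)))
                   (pv≡walkOf (fsuc i) (cong suc (Fin.toℕ-fromℕ< s<l)))
                   (padj P i)
    where
    i : Fin l
    i = fromℕ< s<l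
    pv≡walkOf : ∀ j {t} → toℕ j ≡ t → pv P j ≡ walkOf t
    pv≡walkOf j refl = sym (walkOf-toℕ j)

  walkOf-injective : InjectiveBelow (suc l) walkOf
  walkOf-injective {s} {s'} s<l+1 s'<l+1 eq = Fin.fromℕ<-injective s s' s<l+1 s'<l+1
    (pinj P (trans (sym (walkOf-fromℕ< s<l+1)) (trans eq (walkOf-fromℕ< s'<l+1))))

_∈C?_ : ∀ {n m} {G : SimpleGraph n} (v : Fin n) (C : Cycle G m) → Dec (v ∈C C)
v ∈C? C = Fin.any? (λ c → vtx C c Fin.≟ v)

record Entry {n m} {G : SimpleGraph n} (C : Cycle G m) (w : ℕ → Fin n) (l : ℕ) : Set where
  field
    time      : ℕ
    time≤l    : time ≤ l
    point     : Fin m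
    reaches   : w time ≡ vtx C point
    before    : ∀ {s} → s < time → ¬ (w s ∈C C)
    isWalk    : IsWalk G time w
    injective : InjectiveBelow (suc time) w
open Entry

time>0 : ∀ {n m l} {G : SimpleGraph n} {C : Cycle G m} {w : ℕ → Fin n} →
         ¬ (w 0 ∈C C) → (E : Entry C w l) → 0 < time E
time>0 {w = w} w0∉C E = n≢0⇒n>0 λ t≡0 → w0∉C (point E , sym (trans (cong w (sym t≡0)) (reaches E)))

firstEntry : ∀ {n m l} {G : SimpleGraph n} (C : Cycle G m) (P : Path G l) →
             end P ∈C C → Entry C (walkOf P) l
firstEntry {l = l} C P end∈C
  with i , ¬¬i∈C , earlier∉C ← Fin.¬∀⟶∃¬-smallest (suc l) (λ i → ¬ (pv P i ∈C C))
                                  (λ i → ¬? (pv P i ∈C? C)) (λ all∉C → all∉C (fromℕ l) end∈C)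
  = record
  { time      = toℕ i
  ; time≤l    = i≤l
  ; point     = proj₁ i∈C
  ; reaches   = trans (walkOf-toℕ P i) (sym (proj₂ i∈C))
  ; before    = λ s<i → subst (λ v → ¬ (v ∈C C)) (sym (walkOf-inject s<i)) (earlier∉C (fromℕ< s<i))
  ; isWalk    = λ s<i → walkOf-isWalk P (≤-trans s<i i≤l)
  ; injective = λ s≤i s'≤i → walkOf-injective P (≤-trans s≤i (s≤s i≤l)) (≤-trans s'≤i (s≤s i≤l))
  }
  where
  i∈C : pv P i ∈C C
  i∈C = decidable-stable (pv P i ∈C? C) ¬¬i∈C
  i≤l : toℕ i ≤ l
  i≤l = s≤s⁻¹ (Fin.toℕ<n i)
  walkOf-inject : ∀ {s} (s<i : s < toℕ i) → walkOf P s ≡ pv P (inject (fromℕ< s<i))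
  walkOf-inject s<i =
    trans (cong (walkOf P) (sym (trans (Fin.toℕ-inject (fromℕ< s<i)) (Fin.toℕ-fromℕ< s<i))))
          (walkOf-toℕ P _)

module _ {n m} {G : SimpleGraph n} (C : Cycle G (suc m)) where

  arc : Fin (suc m) → ℕ → Fin n
  arc p s = vtx C (rotate p s)

  arc-isWalk : ∀ {p d} → IsWalk G d (arc p)
  arc-isWalk {p} {s = s} _ = adj C (rotate p s)

  arc-injective : ∀ {p} → InjectiveBelow (suc m) (arc p)
  arc-injective {p} s<m+1 s'<m+1 eq = rotate-injective p s<m+1 s'<m+1 (inj C eq)

  cycle-through-arc : ∀ {x wA wB lA lB d} (A : Entry C wA lA) (B : Entry C wB lB) →
    ¬ (x ∈C C) → wA 0 ≡ x → wB 0 ≡ x →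
    (∀ {s s'} → s ≤ time A → s' ≤ time B → wA s ≡ wB s' → s' ≡ 0) →
    1 ≤ d → d < suc m → rotate (point A) d ≡ point B →
    Cycle G (time A + (d + time B))
  cycle-through-arc {x} {wA} {wB} {d = d} A B x∉C A-start B-start meet-at-start 1≤d d<m+1 rotate≡ =
    closedWalk⇒Cycle (+-mono-≤ (time>0 (off-C A-start) A) (+-mono-≤ 1≤d (time>0 (off-C B-start) B)))
                     walk closed injective'
    where
    a b : ℕ
    a = time A
    b = time B
    R W : ℕ → Fin n
    R = arc (point A) ⟨ d ⟩++ reverse b wB
    W = wA ⟨ a ⟩++ R
    off-C : ∀ {v} → v ≡ x → ¬ (v ∈C C)
    off-C refl = x∉C
    arc-end : arc (point A) d ≡ wB b
    arc-end = trans (cong (vtx C) rotate≡) (sym (reaches B))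
    walk : IsWalk G (a + (d + b)) W
    walk = ++-walk {G = G} (isWalk A)
                   (++-walk {G = G} arc-isWalk (reverse-walk {G = G} (isWalk B)) arc-end)
                   (trans (reaches A) (sym (++-< _ _ d 1≤d)))
    closed : W (a + (d + b)) ≡ W 0
    closed = begin
      W (a + (d + b))  ≡⟨ ++-+ wA R a (d + b) ⟩
      R (d + b)        ≡⟨ ++-+ _ _ d b ⟩
      wB (b ∸ b)       ≡⟨ cong wB (n∸n≡0 b) ⟩
      wB 0             ≡⟨ trans B-start (sym A-start) ⟩
      wA 0             ≡⟨ ++-< wA R a (time>0 (off-C A-start) A) ⟨
      W 0              ∎
      where open ≡-Reasoning
    arc∩B : ∀ {s s'} → s < d → s' < b → arc (point A) s ≢ wB (b ∸ s')
    arc∩B {s} {zero}   s<d _    eq =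
      <⇒≢ s<d (arc-injective (<-trans s<d d<m+1) d<m+1 (trans eq (sym arc-end)))
    arc∩B {s} {suc s'} _   s'<b eq = before B (∸-monoʳ-< z<s (<⇒≤ s'<b)) (_ , eq)
    A∩R : ∀ {s s'} → s < a → s' < d + b → wA s ≢ R s'
    A∩R {s} {s'} s<a s'<d+b eq with side d s'
    ... | left s'<d = before A s<a (_ , sym (trans eq (++-< _ _ d s'<d)))
    ... | right t   = <⇒≢ (m<n⇒0<n∸m (+-cancelˡ-< d t b s'<d+b))
                          (sym (meet-at-start (<⇒≤ s<a) (m∸n≤m b t) (trans eq (++-+ _ _ d t))))
    injective' : InjectiveBelow (a + (d + b)) W
    injective' = ++-injective
      (λ s<a s'<a → injective A (m<n⇒m<1+n s<a) (m<n⇒m<1+n s'<a))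
      (++-injective (λ s<d s'<d → arc-injective (<-trans s<d d<m+1) (<-trans s'<d d<m+1))
                    (λ s<b s'<b → reverse-injective (injective B) (m<n⇒m<1+n s<b) (m<n⇒m<1+n s'<b))
                    arc∩B)
      A∩R

module _ {n m k l} {G : SimpleGraph n} {x : Fin n} {C : Cycle G m} (F : Fan G x C k l) where

  fanWalk : Fin k → ℕ → Fin n
  fanWalk j = walkOf (path F j)

  fanWalk-start : ∀ j → fanWalk j 0 ≡ x
  fanWalk-start j = trans (walkOf-toℕ (path F j) fzero) (starts F j)

  fanWalks-disjoint : ∀ {j j' s s'} → j ≢ j' → s ≤ l → s' ≤ l →
                      fanWalk j s ≡ fanWalk j' s' → s ≡ 0 × s' ≡ 0
  fanWalks-disjoint {j} {j'} {s} {s'} j≢j' s≤l s'≤l eq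
    with i≡0 , i'≡0 ← disjoint F j j' j≢j' (fromℕ< (s≤s s≤l)) (fromℕ< (s≤s s'≤l))
                        (trans (sym (walkOf-fromℕ< (path F j) (s≤s s≤l)))
                               (trans eq (walkOf-fromℕ< (path F j') (s≤s s'≤l))))
    = trans (sym (Fin.toℕ-fromℕ< (s≤s s≤l))) (cong toℕ i≡0) ,
      trans (sym (Fin.toℕ-fromℕ< (s≤s s'≤l))) (cong toℕ i'≡0)

  entry : ∀ j → Entry C (fanWalk j) l
  entry j = firstEntry C (path F j) (ends F j)

  entry-points-distinct : ¬ (x ∈C C) → ∀ {j j'} → j ≢ j' → point (entry j) ≢ point (entry j')
  entry-points-distinct x∉C {j} {j'} j≢j' same =
    <⇒≢ (time>0 x∉C' (entry j')) (sym (proj₂ (fanWalks-disjoint j≢j' (time≤l (entry j)) (time≤l (entry j')) meet)))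
    where
    x∉C' : ¬ (fanWalk j' 0 ∈C C)
    x∉C' = subst (λ v → ¬ (v ∈C C)) (sym (fanWalk-start j')) x∉C
    meet : fanWalk j (time (entry j)) ≡ fanWalk j' (time (entry j'))
    meet = trans (reaches (entry j)) (trans (cong (vtx C) same) (sym (reaches (entry j'))))

lemma2p7 : ∀ {n} (Γ : SignedGraph n) (g : ℕ) → HasGirth (graph Γ) g →
    (C : Cycle (graph Γ) g) → (x : Fin n) → ¬ (x ∈C C) →
    (k l : ℕ) → .{{_ : NonZero k}} → 1 ≤ l →
    Fan (graph Γ) x C k l →
    g ≤ (g / k) + 2 * l
lemma2p7 Γ g _ C x x∉C 1 l _ F rewrite n/1≡n g = m≤m+n g (2 * l)
lemma2p7 Γ zero _ C x x∉C (suc (suc _)) l _ F = contradiction (len≥3 C) λ ()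
lemma2p7 Γ (suc m) (_ , girth-minimal) C x x∉C k@(suc (suc _)) l _ F = begin
  suc m                      ≤⟨ girth-minimal _ cycle ⟩
  time A + (length + time B) ≤⟨ +-mono-≤ (time≤l A) (+-mono-≤ length≤q (time≤l B)) ⟩
  l + (suc m / k + l)        ≡⟨ x+[y+x]≡y+2*x l (suc m / k) ⟩
  suc m / k + 2 * l          ∎
  where
  open ≤-Reasoning
  q<g : suc m / k < suc m
  q<g = m/n<m (suc m) k (s≤s (s≤s z≤n))
  open ShortArc (short-arc (point ∘ entry F) (entry-points-distinct F x∉C) q<g (m<n*[1+m/n] (suc m) k))
  A : Entry C (fanWalk F from) l
  A = entry F from
  B : Entry C (fanWalk F to) l
  B = entry F to
  cycle : Cycle (graph Γ) (time A + (length + time B))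
  cycle = cycle-through-arc C A B x∉C (fanWalk-start F from) (fanWalk-start F to)
            (λ s≤a s'≤b → proj₂ ∘ fanWalks-disjoint F from≢to (≤-trans s≤a (time≤l A))
                                                              (≤-trans s'≤b (time≤l B)))
            1≤length (≤-<-trans length≤q q<g) arrives
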